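{- Let $h,n\ge2$. If $U\le S_h\times\{id\}$ is an anonymity group with respect to $(h,n)$, then $O(U)=U$.
   Context: $G=S_h\times S_n$, $\mathcal P=(S_n)^h$, $G$ acting by $p^{(\varphi,\psi)}$ having $i$-th component $\psi\,p_{\varphi^{ -1}(i)}$ (products are compositions); $p^U=\{p^u:u\in U\}$. $U\le G$ is regular if $\{u\in U:p^u=p\}\subseteq S_h\times\{id\}$ for all $p$ (so every subgroup of $S_h\times\{id\}$ is regular). An SPF is a map $F:\mathcal P\to S_n$; its anonymity group is $G_1(F)=\{(\varphi,id)\in G:F(p^{(\varphi,id)})=F(p)\ \forall p\}$; $U$ is an anonymity group if $U=G_1(F)$ for some SPF $F$. For regular $U$: $V\le_{\mathcal P}U$ means $p^V\subseteq p^U$ for all $p$; $\mathcal A(U)=\{V\le G:V\text{ regular},V\ge U,V\le_{\mathcal P}U\}$; $O(U)=\langle\mathcal A(U)\rangle$. -}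

module Defs where

open import Level using (Level; 0ℓ) renaming (suc to lsuc)
open import Data.Nat using (ℕ)
open import Data.Fin using (Fin)
open import Data.Product using (_×_; _,_; proj₁; proj₂; Σ; ∃)
open import Data.Fin.Permutation
  using (Permutation′; _⟨$⟩ʳ_; _⟨$⟩ˡ_; _∘ₚ_; id; flip)
  renaming (_≈_ to _≈ₚ_)
open import Relation.Unary using (Pred; _∈_; _⊆_)

-- Everything is parameterised by h (number of voters) and n (number of
-- alternatives).
module _ (h n : ℕ) where

  Sh : Set
  Sh = Permutation′ h

  Sn : Set
  Sn = Permutation′ n

  G : Set
  G = Sh × Sn

  _≈G_ : G → G → Set
  (φ , ψ) ≈G (φ′ , ψ′) = (φ ≈ₚ φ′) × (ψ ≈ₚ ψ′)

  eG : G
  eG = (id , id)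

  -- (φ,ψ)(φ′,ψ′) = (φ φ′ , ψ ψ′); products are compositions (φ φ′ = φ ∘ φ′)
  _·G_ : G → G → G
  (φ , ψ) ·G (φ′ , ψ′) = (φ′ ∘ₚ φ , ψ′ ∘ₚ ψ)

  invG : G → G
  invG (φ , ψ) = (flip φ , flip ψ)

  Profile : Set
  Profile = Fin h → Sn

  _≈P_ : Profile → Profile → Set
  p ≈P q = ∀ i → p i ≈ₚ q i

  act : Profile → G → Profile
  act p (φ , ψ) i = p (flip φ ⟨$⟩ʳ i) ∘ₚ ψ

  record IsSubgroup (U : Pred G 0ℓ) : Set where
    field
      resp  : ∀ {g g′} → g ≈G g′ → U g → U g′
      ident : U eG
      mul   : ∀ {g g′} → U g → U g′ → U (g ·G g′)
      inv   : ∀ {g} → U g → U (invG g)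

  InShId : Pred G 0ℓ → Set
  InShId U = ∀ g → U g → proj₂ g ≈ₚ id

  Regular : Pred G 0ℓ → Set
  Regular U = ∀ (p : Profile) (u : G) → U u → act p u ≈P p → proj₂ u ≈ₚ id

  RespectsEq : (Profile → Sn) → Set
  RespectsEq F = ∀ {p q} → p ≈P q → F p ≈ₚ F q

  G₁ : (Profile → Sn) → Pred G 0ℓ
  G₁ F (φ , ψ) = (ψ ≈ₚ id) × (∀ p → F (act p (φ , id)) ≈ₚ F p)

  IsAnonymityGroup : Pred G 0ℓ → Set
  IsAnonymityGroup U =
    Σ (Profile → Sn) λ F → RespectsEq F × (∀ g → (U g → G₁ F g) × (G₁ F g → U g))

  _≤P_ : Pred G 0ℓ → Pred G 0ℓ → Set
  V ≤P U = ∀ (p : Profile) (v : G) → V v → Σ G λ u → U u × (act p v ≈P act p u)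

  𝒜 : Pred G 0ℓ → Pred (Pred G 0ℓ) 0ℓ
  𝒜 U V = IsSubgroup V × Regular V × (U ⊆ V) × (V ≤P U)

  O : Pred G 0ℓ → Pred G (lsuc 0ℓ)
  O U g = ∀ (W : Pred G 0ℓ) → IsSubgroup W → (∀ V → 𝒜 U V → V ⊆ W) → W g

-- Let U = G₁(F) and V ≤_P U. Applied to the constant profile, V ≤_P U forces
-- the S_n-component of every element of V to be trivial, because those of U
-- are. Then every (φ, id) ∈ V moves each profile p to some p^u with u ∈ G₁(F),
-- so F(p^(φ,id)) = F(p) and V ⊆ G₁(F) = U. As U itself lies in A(U), U is the
-- largest member of A(U), hence O(U) = U.
module Submission where

open import Defs
open import Data.Nat using (ℕ; _≥_; s≤s)
open import Data.Product using (_×_; _,_; proj₁; proj₂)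
open import Data.Fin using (Fin; zero)
open import Data.Fin.Permutation using (id) renaming (_≈_ to _≈ₚ_)
open import Relation.Unary using (Pred; _⊆_)
open import Relation.Binary.PropositionalEquality using (refl; sym; trans)
open import Level using (0ℓ)

module _ {h n : ℕ} where

  InShId⇒Regular : ∀ {U} → InShId h n U → Regular h n U
  InShId⇒Regular U⊆Sh p u u∈U _ = U⊆Sh u u∈U

  ≤P-refl : ∀ {U} → _≤P_ h n U U
  ≤P-refl p u u∈U = u , u∈U , λ i x → refl

  InShId⇒∈𝒜 : ∀ {U} → IsSubgroup h n U → InShId h n U → 𝒜 h n U U
  InShId⇒∈𝒜 U≤G U⊆Sh = U≤G , InShId⇒Regular U⊆Sh , (λ u∈U → u∈U) , ≤P-refl

  -- The constant profile detects the S_n-component: (id,…,id)^(φ,ψ) = (ψ,…,ψ).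
  ≤P-InShId : Fin h → ∀ {U V} → _≤P_ h n V U → InShId h n U → InShId h n V
  ≤P-InShId i V≤U U⊆Sh v v∈V x with V≤U (λ _ → id) v v∈V
  ... | u , u∈U , p^v≈p^u = trans (p^v≈p^u i x) (U⊆Sh u u∈U x)

  ≤P-G₁⇒⊆G₁ : Fin h → ∀ {F V} → RespectsEq h n F → _≤P_ h n V (G₁ h n F) → V ⊆ G₁ h n F
  ≤P-G₁⇒⊆G₁ i {F} F-resp V≤G₁ {φ , ψ} v∈V = ψ≈id , F-invariant
    where
    ψ≈id : ψ ≈ₚ id
    ψ≈id = ≤P-InShId i V≤G₁ (λ u u∈G₁ → proj₁ u∈G₁) (φ , ψ) v∈V

    F-invariant : ∀ p → F (act h n p (φ , id)) ≈ₚ F p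
    F-invariant p with V≤G₁ p (φ , ψ) v∈V
    ... | (φ′ , ψ′) , (ψ′≈id , F-invariant′) , p^v≈p^u =
      λ x → trans (F-resp p^φ≈p^φ′ x) (F-invariant′ p x)
      where
      p^φ≈p^φ′ : _≈P_ h n (act h n p (φ , id)) (act h n p (φ′ , id))
      p^φ≈p^φ′ i x =
        trans (sym (ψ≈id _)) (trans (p^v≈p^u i x) (ψ′≈id _))

  ≤P-monoʳ : ∀ {V U U′} → U ⊆ U′ → _≤P_ h n V U → _≤P_ h n V U′
  ≤P-monoʳ U⊆U′ V≤U p v v∈V with V≤U p v v∈V
  ... | u , u∈U , p^v≈p^u = u , U⊆U′ u∈U , p^v≈p^u

  ≤P-anonymityGroup⇒⊆ : Fin h → ∀ {U V} → IsAnonymityGroup h n U → _≤P_ h n V U → V ⊆ U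
  ≤P-anonymityGroup⇒⊆ i (F , F-resp , U⇔G₁) V≤U {v} v∈V =
    proj₂ (U⇔G₁ v) (≤P-G₁⇒⊆G₁ i {F} F-resp (≤P-monoʳ (λ {g} → proj₁ (U⇔G₁ g)) V≤U) v∈V)

corollary52 : ∀ (h n : ℕ) → h ≥ 2 → n ≥ 2 →
    (U : Pred (G h n) 0ℓ) → IsSubgroup h n U → InShId h n U →
    IsAnonymityGroup h n U →
    ∀ g → (O h n U g → U g) × (U g → O h n U g)
-- Only one voter is needed (h ≥ 1).
corollary52 h n (s≤s _) _ U U≤G U⊆Sh U-anonymity g =
  (λ g∈O → g∈O U U≤G λ V (_ , _ , _ , V≤U) → ≤P-anonymityGroup⇒⊆ zero U-anonymity V≤U)
  , λ g∈U W _ 𝒜⊆W → 𝒜⊆W U (InShId⇒∈𝒜 U≤G U⊆Sh) g∈U
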